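{- For every string $\sigma\in A^s$, $\mathrm{EqMFEL}\vdash\neg\mathsf F_\sigma=\mathsf T_\sigma$ and $\mathrm{EqMFEL}\vdash\widetilde{\mathsf F}_\sigma=\mathsf F_\sigma$. Moreover, if $\sigma=a\rho$ with $a\in A$, then $\mathrm{EqMFEL}\vdash\widetilde{\mathsf F}_\sigma=\neg a\mathbin{\wedge_\bullet}\widetilde{\mathsf F}_\rho$.
   Context: $A$ is a countable set of atoms; $A^s$ is the set of finite strings over $A$ in which no atom occurs more than once. Terms are built from $\mathsf T,\mathsf F$, atoms, $\neg$, $\mathbin{\wedge_\bullet}$, $\mathbin{\vee_\bullet}$. Define $\mathsf T_\epsilon=\mathsf T$, $\mathsf T_{a\rho}=(a\mathbin{\wedge_\bullet}\mathsf T_\rho)\mathbin{\vee_\bullet}(\neg a\mathbin{\wedge_\bullet}\mathsf T_\rho)$; $\mathsf F_\epsilon=\mathsf F$, $\mathsf F_{a\rho}=(a\mathbin{\wedge_\bullet}\mathsf F_\rho)\mathbin{\vee_\bullet}(\neg a\mathbin{\wedge_\bullet}\mathsf F_\rho)$; $\widetilde{\mathsf F}_\epsilon=\mathsf F$, $\widetilde{\mathsf F}_{a\rho}=a\mathbin{\wedge_\bullet}\widetilde{\mathsf F}_\rho$. $\mathrm{EqMFEL}$ consists of: $\mathsf F=\neg\mathsf T$; $x\mathbin{\vee_\bullet}y=\neg(\neg x\mathbin{\wedge_\bullet}\neg y)$; $\neg\neg x=x$; $(x\mathbin{\wedge_\bullet}y)\mathbin{\wedge_\bullet}z=x\mathbin{\wedge_\bullet}(y\mathbin{\wedge_\bullet}z)$;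 $\mathsf T\mathbin{\wedge_\bullet}x=x$; $x\mathbin{\wedge_\bullet}\mathsf T=x$; $x\mathbin{\wedge_\bullet}\mathsf F=\mathsf F\mathbin{\wedge_\bullet}x$; $\neg x\mathbin{\wedge_\bullet}\mathsf F=x\mathbin{\wedge_\bullet}\mathsf F$; $(x\mathbin{\wedge_\bullet}\mathsf F)\mathbin{\vee_\bullet}y=(x\mathbin{\vee_\bullet}\mathsf T)\mathbin{\wedge_\bullet}y$; $x\mathbin{\vee_\bullet}(y\mathbin{\wedge_\bullet}\mathsf F)=x\mathbin{\wedge_\bullet}(y\mathbin{\vee_\bullet}\mathsf T)$; $(x\mathbin{\vee_\bullet}y)\mathbin{\wedge_\bullet}z=(\neg x\mathbin{\wedge_\bullet}(y\mathbin{\wedge_\bullet}z))\mathbin{\vee_\bullet}(x\mathbin{\wedge_\bullet}z)$. $\vdash$ is derivability in equational logic. -}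

module Defs where

open import Data.Nat using (ℕ)
open import Data.List using (List; []; _∷_)
open import Data.List.Relation.Unary.Unique.Propositional using (Unique)

-- Atoms: A is a countable set; we take A = ℕ.
Atom : Set
Atom = ℕ

data Term : Set where
  var  : ℕ → Term
  T F  : Term
  atom : Atom → Term
  ¬'_  : Term → Term
  _∧●_ : Term → Term → Term
  _∨●_ : Term → Term → Term

infix  9 ¬'_
infixr 7 _∧●_
infixr 6 _∨●_

_[_] : Term → (ℕ → Term) → Term
var i    [ s ] = s i
T        [ s ] = T
F        [ s ] = F
atom a   [ s ] = atom a
(¬' t)   [ s ] = ¬' (t [ s ])
(t ∧● u) [ s ] = (t [ s ]) ∧● (u [ s ])
(t ∨● u) [ s ] = (t [ s ]) ∨● (u [ s ])

record Str : Set where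
  constructor str
  field
    list   : List Atom
    unique : Unique list

-- T_σ, F_σ, F̃_σ (depend only on the underlying list)
Tσ : List Atom → Term
Tσ []      = T
Tσ (a ∷ ρ) = (atom a ∧● Tσ ρ) ∨● (¬' atom a ∧● Tσ ρ)

Fσ : List Atom → Term
Fσ []      = F
Fσ (a ∷ ρ) = (atom a ∧● Fσ ρ) ∨● (¬' atom a ∧● Fσ ρ)

F̃σ : List Atom → Term
F̃σ []      = F
F̃σ (a ∷ ρ) = atom a ∧● F̃σ ρ

private
  x y z : Term
  x = var 0
  y = var 1
  z = var 2

data Axiom : Term → Term → Set where
  ax-F    : Axiom F (¬' T)
  ax-∨    : Axiom (x ∨● y) (¬' (¬' x ∧● ¬' y))
  ax-¬¬   : Axiom (¬' ¬' x) x
  ax-assoc : Axiom ((x ∧● y) ∧● z) (x ∧● (y ∧● z))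
  ax-Tl   : Axiom (T ∧● x) x
  ax-Tr   : Axiom (x ∧● T) x
  ax-F-comm : Axiom (x ∧● F) (F ∧● x)
  ax-¬F   : Axiom (¬' x ∧● F) (x ∧● F)
  ax-F∨   : Axiom ((x ∧● F) ∨● y) ((x ∨● T) ∧● y)
  ax-∨F   : Axiom (x ∨● (y ∧● F)) (x ∧● (y ∨● T))
  ax-distr : Axiom ((x ∨● y) ∧● z) ((¬' x ∧● (y ∧● z)) ∨● (x ∧● z))

infix 4 EqMFEL⊢_≈_
data EqMFEL⊢_≈_ : Term → Term → Set where
  axiom : ∀ {l r} → Axiom l r → (s : ℕ → Term) → EqMFEL⊢ l [ s ] ≈ r [ s ]
  refl  : ∀ {t} → EqMFEL⊢ t ≈ t
  sym   : ∀ {t u} → EqMFEL⊢ t ≈ u → EqMFEL⊢ u ≈ t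
  trans : ∀ {t u v} → EqMFEL⊢ t ≈ u → EqMFEL⊢ u ≈ v → EqMFEL⊢ t ≈ v
  cong¬ : ∀ {t u} → EqMFEL⊢ t ≈ u → EqMFEL⊢ ¬' t ≈ ¬' u
  cong∧ : ∀ {t t' u u'} → EqMFEL⊢ t ≈ t' → EqMFEL⊢ u ≈ u' → EqMFEL⊢ t ∧● u ≈ t' ∧● u'
  cong∨ : ∀ {t t' u u'} → EqMFEL⊢ t ≈ t' → EqMFEL⊢ u ≈ u' → EqMFEL⊢ t ∨● u ≈ t' ∨● u'

-- F_σ and F̃_σ are both provably equal to c ∧● F, where c = ⋀ σ is the
-- conjunction of the atoms of σ.  In such a term the left conjunct may be
-- negated freely, since x ∧● (y ∧● F) = (x ∧● F) ∧● y by associativity and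
-- F-commutation, and ¬x ∧● F = x ∧● F.  Together with
-- (x ∧● q) ∨● (¬x ∧● q) = (¬x ∨● T) ∧● q and (x ∨● T) ∧● F = x ∧● F, this
-- collapses each case split in F_σ by induction on σ; the same computation
-- under ¬ turns T_σ into ¬(c ∧● F).
module Submission where

open import Defs
open import Data.Product using (_×_; _,_)
open import Data.List using (List; []; _∷_)
open import Data.Nat using (ℕ; zero; suc)
open import Level using (0ℓ)
open import Relation.Binary.Bundles using (Setoid)
open import Relation.Binary.PropositionalEquality using (_≡_)
import Relation.Binary.PropositionalEquality as ≡

≈-setoid : Setoid 0ℓ 0ℓ
≈-setoid = record
  { Carrier       = Term
  ; _≈_           = EqMFEL⊢_≈_
  ; isEquivalence = record { refl = refl ; sym = sym ; trans = trans }
  }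

open import Relation.Binary.Reasoning.Setoid ≈-setoid

assign : Term → Term → Term → ℕ → Term
assign x y z zero          = x
assign x y z (suc zero)    = y
assign x y z (suc (suc _)) = z

F≈¬T : EqMFEL⊢ F ≈ ¬' T
F≈¬T = axiom ax-F (assign T T T)

∨≈¬∧¬ : ∀ x y → EqMFEL⊢ x ∨● y ≈ ¬' (¬' x ∧● ¬' y)
∨≈¬∧¬ x y = axiom ax-∨ (assign x y T)

¬-involutive : ∀ x → EqMFEL⊢ ¬' ¬' x ≈ x
¬-involutive x = axiom ax-¬¬ (assign x T T)

∧-assoc : ∀ x y z → EqMFEL⊢ (x ∧● y) ∧● z ≈ x ∧● (y ∧● z)
∧-assoc x y z = axiom ax-assoc (assign x y z)

∧-identityˡ : ∀ x → EqMFEL⊢ T ∧● x ≈ x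
∧-identityˡ x = axiom ax-Tl (assign x T T)

∧F-comm : ∀ x → EqMFEL⊢ x ∧● F ≈ F ∧● x
∧F-comm x = axiom ax-F-comm (assign x T T)

¬∧F≈∧F : ∀ x → EqMFEL⊢ ¬' x ∧● F ≈ x ∧● F
¬∧F≈∧F x = axiom ax-¬F (assign x T T)

∧F-∨ : ∀ x y → EqMFEL⊢ (x ∧● F) ∨● y ≈ (x ∨● T) ∧● y
∧F-∨ x y = axiom ax-F∨ (assign x y T)

∨-distribʳ-∧ : ∀ x y z → EqMFEL⊢ (x ∨● y) ∧● z ≈ (¬' x ∧● (y ∧● z)) ∨● (x ∧● z)
∨-distribʳ-∧ x y z = axiom ax-distr (assign x y z)

F∧F≈F : EqMFEL⊢ F ∧● F ≈ F
F∧F≈F = begin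
  F ∧● F     ≈⟨ cong∧ F≈¬T refl ⟩
  ¬' T ∧● F  ≈⟨ ¬∧F≈∧F T ⟩
  T ∧● F     ≈⟨ ∧-identityˡ F ⟩
  F          ∎

∨T≈¬∧F : ∀ x → EqMFEL⊢ x ∨● T ≈ ¬' (x ∧● F)
∨T≈¬∧F x = begin
  x ∨● T                ≈⟨ ∨≈¬∧¬ x T ⟩
  ¬' (¬' x ∧● ¬' T)     ≈⟨ cong¬ (cong∧ refl F≈¬T) ⟨
  ¬' (¬' x ∧● F)        ≈⟨ cong¬ (¬∧F≈∧F x) ⟩
  ¬' (x ∧● F)           ∎

∨T∧F≈∧F : ∀ x → EqMFEL⊢ (x ∨● T) ∧● F ≈ x ∧● F
∨T∧F≈∧F x = begin
  (x ∨● T) ∧● F          ≈⟨ cong∧ (∨T≈¬∧F x) refl ⟩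
  ¬' (x ∧● F) ∧● F       ≈⟨ ¬∧F≈∧F (x ∧● F) ⟩
  (x ∧● F) ∧● F          ≈⟨ ∧-assoc x F F ⟩
  x ∧● (F ∧● F)          ≈⟨ cong∧ refl F∧F≈F ⟩
  x ∧● F                 ∎

∧-∧F≈∧F-∧ : ∀ x y → EqMFEL⊢ x ∧● (y ∧● F) ≈ (x ∧● F) ∧● y
∧-∧F≈∧F-∧ x y = begin
  x ∧● (y ∧● F)   ≈⟨ ∧-assoc x y F ⟨
  (x ∧● y) ∧● F   ≈⟨ ∧F-comm (x ∧● y) ⟩
  F ∧● (x ∧● y)   ≈⟨ ∧-assoc F x y ⟨
  (F ∧● x) ∧● y   ≈⟨ cong∧ (∧F-comm x) refl ⟨
  (x ∧● F) ∧● y   ∎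

∧-∧F-congˡ : ∀ {x x′} y → EqMFEL⊢ x ∧● F ≈ x′ ∧● F
           → EqMFEL⊢ x ∧● (y ∧● F) ≈ x′ ∧● (y ∧● F)
∧-∧F-congˡ {x} {x′} y x∧F≈x′∧F = begin
  x ∧● (y ∧● F)    ≈⟨ ∧-∧F≈∧F-∧ x y ⟩
  (x ∧● F) ∧● y    ≈⟨ cong∧ x∧F≈x′∧F refl ⟩
  (x′ ∧● F) ∧● y   ≈⟨ ∧-∧F≈∧F-∧ x′ y ⟨
  x′ ∧● (y ∧● F)   ∎

¬-∧-∧F : ∀ x y → EqMFEL⊢ ¬' x ∧● (y ∧● F) ≈ x ∧● (y ∧● F)
¬-∧-∧F x y = ∧-∧F-congˡ y (¬∧F≈∧F x)

∨T-∧-∧F : ∀ x y → EqMFEL⊢ (x ∨● T) ∧● (y ∧● F) ≈ x ∧● (y ∧● F)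
∨T-∧-∧F x y = ∧-∧F-congˡ y (∨T∧F≈∧F x)

∨T-∧-¬∧F : ∀ x y → EqMFEL⊢ (x ∨● T) ∧● ¬' (y ∧● F) ≈ ¬' (x ∧● (y ∧● F))
∨T-∧-¬∧F x y = begin
  (x ∨● T) ∧● ¬' (y ∧● F)             ≈⟨ ∧F-∨ x _ ⟨
  (x ∧● F) ∨● ¬' (y ∧● F)             ≈⟨ ∨≈¬∧¬ _ _ ⟩
  ¬' (¬' (x ∧● F) ∧● ¬' ¬' (y ∧● F))  ≈⟨ cong¬ (cong∧ (sym (∨T≈¬∧F x)) (¬-involutive (y ∧● F))) ⟩
  ¬' ((x ∨● T) ∧● (y ∧● F))           ≈⟨ cong¬ (∨T-∧-∧F x y) ⟩
  ¬' (x ∧● (y ∧● F))                  ∎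

∧-∨-¬∧≈¬∨T-∧ : ∀ x q → EqMFEL⊢ (x ∧● q) ∨● (¬' x ∧● q) ≈ (¬' x ∨● T) ∧● q
∧-∨-¬∧≈¬∨T-∧ x q = begin
  (x ∧● q) ∨● (¬' x ∧● q)              ≈⟨ cong∨ (cong∧ (¬-involutive x) (∧-identityˡ q)) refl ⟨
  (¬' ¬' x ∧● (T ∧● q)) ∨● (¬' x ∧● q) ≈⟨ ∨-distribʳ-∧ (¬' x) T q ⟨
  (¬' x ∨● T) ∧● q                     ∎

⋀ : List Atom → Term
⋀ []      = T
⋀ (a ∷ ρ) = atom a ∧● ⋀ ρ

F̃σ≈⋀∧F : ∀ ρ → EqMFEL⊢ F̃σ ρ ≈ ⋀ ρ ∧● F
F̃σ≈⋀∧F []      = sym (∧-identityˡ F)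
F̃σ≈⋀∧F (a ∷ ρ) = begin
  atom a ∧● F̃σ ρ        ≈⟨ cong∧ refl (F̃σ≈⋀∧F ρ) ⟩
  atom a ∧● (⋀ ρ ∧● F)  ≈⟨ ∧-assoc (atom a) (⋀ ρ) F ⟨
  ⋀ (a ∷ ρ) ∧● F        ∎

Fσ≈⋀∧F : ∀ ρ → EqMFEL⊢ Fσ ρ ≈ ⋀ ρ ∧● F
Fσ≈⋀∧F []      = sym (∧-identityˡ F)
Fσ≈⋀∧F (a ∷ ρ) = begin
  (atom a ∧● Fσ ρ) ∨● (¬' atom a ∧● Fσ ρ) ≈⟨ ∧-∨-¬∧≈¬∨T-∧ (atom a) (Fσ ρ) ⟩
  (¬' atom a ∨● T) ∧● Fσ ρ                ≈⟨ cong∧ refl (Fσ≈⋀∧F ρ) ⟩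
  (¬' atom a ∨● T) ∧● (⋀ ρ ∧● F)          ≈⟨ ∨T-∧-∧F (¬' atom a) (⋀ ρ) ⟩
  ¬' atom a ∧● (⋀ ρ ∧● F)                 ≈⟨ ¬-∧-∧F (atom a) (⋀ ρ) ⟩
  atom a ∧● (⋀ ρ ∧● F)                    ≈⟨ ∧-assoc (atom a) (⋀ ρ) F ⟨
  ⋀ (a ∷ ρ) ∧● F                          ∎

Tσ≈¬⋀∧F : ∀ ρ → EqMFEL⊢ Tσ ρ ≈ ¬' (⋀ ρ ∧● F)
Tσ≈¬⋀∧F []      = begin
  T             ≈⟨ ¬-involutive T ⟨
  ¬' ¬' T       ≈⟨ cong¬ F≈¬T ⟨
  ¬' F          ≈⟨ cong¬ (∧-identityˡ F) ⟨
  ¬' (T ∧● F)   ∎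
Tσ≈¬⋀∧F (a ∷ ρ) = begin
  (atom a ∧● Tσ ρ) ∨● (¬' atom a ∧● Tσ ρ) ≈⟨ ∧-∨-¬∧≈¬∨T-∧ (atom a) (Tσ ρ) ⟩
  (¬' atom a ∨● T) ∧● Tσ ρ                ≈⟨ cong∧ refl (Tσ≈¬⋀∧F ρ) ⟩
  (¬' atom a ∨● T) ∧● ¬' (⋀ ρ ∧● F)       ≈⟨ ∨T-∧-¬∧F (¬' atom a) (⋀ ρ) ⟩
  ¬' (¬' atom a ∧● (⋀ ρ ∧● F))            ≈⟨ cong¬ (¬-∧-∧F (atom a) (⋀ ρ)) ⟩
  ¬' (atom a ∧● (⋀ ρ ∧● F))               ≈⟨ cong¬ (∧-assoc (atom a) (⋀ ρ) F) ⟨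
  ¬' (⋀ (a ∷ ρ) ∧● F)                     ∎

¬Fσ≈Tσ : ∀ ρ → EqMFEL⊢ ¬' Fσ ρ ≈ Tσ ρ
¬Fσ≈Tσ ρ = trans (cong¬ (Fσ≈⋀∧F ρ)) (sym (Tσ≈¬⋀∧F ρ))

F̃σ≈Fσ : ∀ ρ → EqMFEL⊢ F̃σ ρ ≈ Fσ ρ
F̃σ≈Fσ ρ = trans (F̃σ≈⋀∧F ρ) (sym (Fσ≈⋀∧F ρ))

F̃σ-negate-head : ∀ a ρ → EqMFEL⊢ F̃σ (a ∷ ρ) ≈ ¬' atom a ∧● F̃σ ρ
F̃σ-negate-head a ρ = begin
  atom a ∧● F̃σ ρ           ≈⟨ cong∧ refl (F̃σ≈⋀∧F ρ) ⟩
  atom a ∧● (⋀ ρ ∧● F)     ≈⟨ ¬-∧-∧F (atom a) (⋀ ρ) ⟨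
  ¬' atom a ∧● (⋀ ρ ∧● F)  ≈⟨ cong∧ refl (F̃σ≈⋀∧F ρ) ⟨
  ¬' atom a ∧● F̃σ ρ        ∎

lemma4p10 : (σ : Str)
    → (EqMFEL⊢ ¬' Fσ (Str.list σ) ≈ Tσ (Str.list σ))
    × (EqMFEL⊢ F̃σ (Str.list σ) ≈ Fσ (Str.list σ))
    × (∀ (a : Atom) (ρ : List Atom) → Str.list σ ≡ a ∷ ρ
    → EqMFEL⊢ F̃σ (Str.list σ) ≈ ¬' atom a ∧● F̃σ ρ)
lemma4p10 (str σ _) =
  ¬Fσ≈Tσ σ , F̃σ≈Fσ σ , λ { a ρ ≡.refl → F̃σ-negate-head a ρ }
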